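{- For all $n\ge1$, $$a_{n,3,00}=\binom{n+1}{2}+2\binom{n}{3}+\binom{n-1}{4}+\binom{n+2}{5}.$$
   Context: For a finite integer sequence $(a_1,\dots,a_i)$, $\mathrm{asc}(a_1,\dots,a_i)=|\{j:1\le j<i,\ a_j<a_{j+1}\}|$. For an integer $p\ge1$, a $p$-ascent sequence of length $n\ge1$ is a sequence $(a_1,\dots,a_n)$ of nonnegative integers with $a_1=0$ and $a_i\le p+\mathrm{asc}(a_1,\dots,a_{i-1})$ for all $2\le i\le n$. $a_{n,p,00}$ is the number of $p$-ascent sequences of length $n$ avoiding the pattern $00$, i.e. having all letters distinct. Binomial coefficients $\binom{m}{k}$ with $0\le m<k$ are $0$. -}

module Defs where

open import Data.Nat using (ℕ; zero; suc; _+_; _<_; _≤_; _<ᵇ_)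
open import Data.Nat.Properties using (_≤?_; _<?_; _≟_)
open import Data.List using (List; []; _∷_; length; map; concatMap; upTo; filter; _∷ʳ_)
open import Data.List.Relation.Unary.All using (All)
open import Data.List.Relation.Unary.Unique.Propositional using (Unique)
open import Data.List.Relation.Unary.Unique.DecPropositional _≟_ using (unique?)
open import Data.Product using (_×_)
open import Data.Unit using (⊤)
open import Relation.Binary.PropositionalEquality using (_≡_)
open import Relation.Nullary using (Dec; yes; no)
open import Relation.Nullary.Decidable using (_×-dec_)

ascFrom : ℕ → List ℕ → ℕ
ascFrom x [] = 0
ascFrom x (y ∷ ys) with x <? y
... | yes _ = suc (ascFrom y ys)
... | no _  = ascFrom y ys

asc : List ℕ → ℕ
asc [] = 0
asc (x ∷ xs) = ascFrom x xs

TailOK : ℕ → List ℕ → List ℕ → Set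
TailOK p pre [] = ⊤
TailOK p pre (a ∷ rest) = (a ≤ p + asc pre) × TailOK p (pre ∷ʳ a) rest

tailOK? : (p : ℕ) (pre rest : List ℕ) → Dec (TailOK p pre rest)
tailOK? p pre [] = yes _
tailOK? p pre (a ∷ rest) = (a ≤? p + asc pre) ×-dec tailOK? p (pre ∷ʳ a) rest

data IsPAscent (p : ℕ) : List ℕ → Set where
  pasc : ∀ {rest} → TailOK p (0 ∷ []) rest → IsPAscent p (0 ∷ rest)

isPAscent? : (p : ℕ) (xs : List ℕ) → Dec (IsPAscent p xs)
isPAscent? p [] = no (λ ())
isPAscent? p (zero ∷ rest) with tailOK? p (0 ∷ []) rest
... | yes t = yes (pasc t)
... | no ¬t = no (λ { (pasc t) → ¬t t })
isPAscent? p (suc x ∷ rest) = no (λ ())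

lists : ℕ → ℕ → List (List ℕ)
lists b zero = [] ∷ []
lists b (suc n) = concatMap (λ x → map (x ∷_) (lists b n)) (upTo b)

Avoids00 : List ℕ → Set
Avoids00 = Unique

-- Every letter of a p-ascent sequence of length n is ≤ p + n, so enumerating
-- lists with entries < suc (p + n) covers all of them.
a00 : ℕ → ℕ → ℕ
a00 n p = length (filter (λ xs → isPAscent? p xs ×-dec unique? xs) (lists (suc (p + n)) n))

-- Read a 00-avoiding p-ascent sequence letter by letter. How many ways a prefix can be
-- completed depends only on two numbers: the number i of unused values below its last
-- letter, and the number k of unused values up to the current bound p + asc. Appending
-- the v-th unused value is an ascent iff i ≤ v, and an ascent raises the bound by one,
-- which frees exactly one new value; so k never increases and the counts obey the
-- recursion `completions`, started from i = 0, k = p after the first letter 0. For p = 3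
-- only six states (i, k) are reachable, and Pascal's rule solves their recursions.
module Submission where

open import Defs
open import Data.Nat.Properties
open import Data.Bool using (Bool; true; false; if_then_else_; _∧_)
open import Data.List using (List; []; _∷_; length; map; concatMap; upTo; filter; _∷ʳ_; _++_; [_])
open import Data.List.Properties using (upTo-∷ʳ; concatMap-++; ++-identityʳ)
open import Data.List.Membership.Propositional using (_∈_; _∉_)
open import Data.List.Membership.Propositional.Properties using (∈-++⁺ˡ; ∈-++⁺ʳ; ∈-++⁻)
open import Data.List.Membership.DecPropositional _≟_ using (_∈?_; _∉?_)
open import Data.List.Relation.Unary.All as All using (All; []; _∷_; all?)
open import Data.List.Relation.Unary.All.Properties using (∷ʳ⁺)
open import Data.List.Relation.Unary.AllPairs using ([]; _∷_)
open import Data.List.Relation.Unary.Any using (here; there)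
open import Data.List.Relation.Unary.Unique.Propositional using (Unique)
import Data.List.Relation.Unary.Unique.Propositional.Properties as Unique
open import Data.List.Relation.Unary.Unique.DecPropositional _≟_ using (unique?)
open import Data.Nat using (ℕ; zero; suc; _+_; _*_; _∸_; _≤_; _<_; z≤n; s≤s)
open import Data.Nat.Combinatorics using (_C_; nC1≡n; nCk+nC[k+1]≡[n+1]C[k+1])
open import Data.Nat.Tactic.RingSolver using (solve-∀)
open import Data.Product using (_×_; _,_; proj₂)
open import Data.Sum using (inj₁; inj₂)
open import Function using (_∘_)
open import Function.Bundles using (_⇔_; mk⇔)
open import Relation.Binary.PropositionalEquality
  using (_≡_; _≢_; refl; sym; trans; cong; cong₂; subst; module ≡-Reasoning)
open import Relation.Nullary using (Dec; yes; no; does; contradiction)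
open import Relation.Nullary.Decidable using (_×-dec_; dec-true; dec-false; does-⇔)

𝟙 : Bool → ℕ
𝟙 true  = 1
𝟙 false = 0

𝟙≤1 : ∀ b → 𝟙 b ≤ 1
𝟙≤1 true  = ≤-refl
𝟙≤1 false = z≤n

count : {A : Set} → (A → Bool) → List A → ℕ
count f []       = 0
count f (x ∷ xs) = 𝟙 (f x) + count f xs

module _ {A : Set} where

  length-filter≡count : {P : A → Set} (P? : ∀ x → Dec (P x)) (xs : List A) →
                        length (filter P? xs) ≡ count (does ∘ P?) xs
  length-filter≡count P? []       = refl
  length-filter≡count P? (x ∷ xs) with does (P? x)
  ... | true  = cong suc (length-filter≡count P? xs)
  ... | false = length-filter≡count P? xs

  count-++ : (f : A → Bool) (xs ys : List A) → count f (xs ++ ys) ≡ count f xs + count f ys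
  count-++ f []       ys = refl
  count-++ f (x ∷ xs) ys =
    trans (cong (𝟙 (f x) +_) (count-++ f xs ys)) (sym (+-assoc (𝟙 (f x)) (count f xs) (count f ys)))

  count-cong : {f g : A → Bool} → (∀ x → f x ≡ g x) → (xs : List A) → count f xs ≡ count g xs
  count-cong f≗g []       = refl
  count-cong f≗g (x ∷ xs) = cong₂ _+_ (cong 𝟙 (f≗g x)) (count-cong f≗g xs)

  count-false : (xs : List A) → count (λ _ → false) xs ≡ 0
  count-false []       = refl
  count-false (x ∷ xs) = count-false xs

  count-∧ : (b : Bool) (f : A → Bool) (xs : List A) →
            count (λ x → b ∧ f x) xs ≡ (if b then count f xs else 0)
  count-∧ true  f xs = refl
  count-∧ false f xs = count-false xs

if-does-cong : ∀ {P : Set} (P? : Dec P) {m n o : ℕ} → (P → m ≡ n) →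
               (if does P? then m else o) ≡ (if does P? then n else o)
if-does-cong (yes p) m≡n = m≡n p
if-does-cong (no  _) _   = refl

count-map : {A B : Set} (f : B → Bool) (g : A → B) (xs : List A) →
            count f (map g xs) ≡ count (f ∘ g) xs
count-map f g []       = refl
count-map f g (x ∷ xs) = cong (𝟙 (f (g x)) +_) (count-map f g xs)

sumBelow : ℕ → (ℕ → ℕ) → ℕ
sumBelow zero    f = 0
sumBelow (suc m) f = sumBelow m f + f m

sumBelow-cong : ∀ m {f g : ℕ → ℕ} → (∀ x → x < m → f x ≡ g x) → sumBelow m f ≡ sumBelow m g
sumBelow-cong zero    f≗g = refl
sumBelow-cong (suc m) f≗g =
  cong₂ _+_ (sumBelow-cong m (λ x x<m → f≗g x (m<n⇒m<1+n x<m))) (f≗g m ≤-refl)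

sumBelow-vanishing : ∀ {m n} (f : ℕ → ℕ) → (∀ x → m ≤ x → f x ≡ 0) → m ≤ n →
                     sumBelow n f ≡ sumBelow m f
sumBelow-vanishing {m} {n} f vanish m≤n =
  subst (λ k → sumBelow k f ≡ sumBelow m f) (m∸n+n≡m m≤n) (extend (n ∸ m))
  where
  extend : ∀ d → sumBelow (d + m) f ≡ sumBelow m f
  extend zero    = refl
  extend (suc d) = trans (cong₂ _+_ (extend d) (vanish (d + m) (m≤n+m m d))) (+-identityʳ _)

count-concatMap-upTo : {A : Set} (f : A → Bool) (g : ℕ → List A) (m : ℕ) →
                       count f (concatMap g (upTo m)) ≡ sumBelow m (count f ∘ g)
count-concatMap-upTo f g zero    = refl
count-concatMap-upTo f g (suc m) = begin
  count f (concatMap g (upTo (suc m)))              ≡⟨ cong (count f ∘ concatMap g) (sym (upTo-∷ʳ m)) ⟩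
  count f (concatMap g (upTo m ∷ʳ m))               ≡⟨ cong (count f) (concatMap-++ g (upTo m) [ m ]) ⟩
  count f (concatMap g (upTo m) ++ (g m ++ []))     ≡⟨ count-++ f (concatMap g (upTo m)) (g m ++ []) ⟩
  count f (concatMap g (upTo m)) + count f (g m ++ [])
    ≡⟨ cong₂ _+_ (count-concatMap-upTo f g m) (cong (count f) (++-identityʳ (g m))) ⟩
  sumBelow m (count f ∘ g) + count f (g m)          ∎
  where open ≡-Reasoning

∉-∷ʳ : ∀ {y x : ℕ} {xs} → y ∉ xs → y ≢ x → y ∉ xs ∷ʳ x
∉-∷ʳ {xs = xs} y∉ y≢x y∈ with ∈-++⁻ xs y∈
... | inj₁ y∈xs       = y∉ y∈xs
... | inj₂ (here y≡x) = y≢x y≡x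

does-∉-∷ʳ : ∀ {y x : ℕ} {xs} → y ≢ x → does (y ∉? xs ∷ʳ x) ≡ does (y ∉? xs)
does-∉-∷ʳ {y} {x} {xs} y≢x =
  does-⇔ (mk⇔ (λ y∉ y∈ → y∉ (∈-++⁺ˡ y∈)) (λ y∉ → ∉-∷ʳ y∉ y≢x)) (y ∉? xs ∷ʳ x) (y ∉? xs)

unique-∷ʳ : ∀ {xs} {x : ℕ} → Unique xs → x ∉ xs → Unique (xs ∷ʳ x)
unique-∷ʳ u x∉ = Unique.++⁺ u ([] ∷ []) (λ { (x∈ , here refl) → x∉ x∈ })

free : List ℕ → ℕ → ℕ
free xs zero    = 0
free xs (suc m) = free xs m + 𝟙 (does (m ∉? xs))

free-suc-∉ : ∀ {xs m} → m ∉ xs → free xs (suc m) ≡ suc (free xs m)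
free-suc-∉ {xs} {m} m∉ =
  trans (cong (λ b → free xs m + 𝟙 b) (dec-true (m ∉? xs) m∉)) (+-comm (free xs m) 1)

free-mono : ∀ xs {m n} → m ≤ n → free xs m ≤ free xs n
free-mono xs {n = zero}  z≤n = ≤-refl
free-mono xs {n = suc n} m≤ with m≤n⇒m<n∨m≡n m≤
... | inj₁ (s≤s m≤n) = ≤-trans (free-mono xs m≤n) (m≤m+n _ _)
... | inj₂ refl      = ≤-refl

free-∷ʳ-≤ : ∀ {xs x m} → m ≤ x → free (xs ∷ʳ x) m ≡ free xs m
free-∷ʳ-≤ {m = zero}          _   = refl
free-∷ʳ-≤ {xs} {x} {suc m} m<x =
  cong₂ _+_ (free-∷ʳ-≤ {xs} (<⇒≤ m<x)) (cong 𝟙 (does-∉-∷ʳ {xs = xs} (<⇒≢ m<x)))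

free-∷ʳ-> : ∀ {xs x m} → x ∉ xs → x < m → suc (free (xs ∷ʳ x) m) ≡ free xs m
free-∷ʳ-> {xs} {x} {suc m} x∉ (s≤s x≤m) with m≤n⇒m<n∨m≡n x≤m
... | inj₁ x<m =
  cong₂ _+_ (free-∷ʳ-> x∉ x<m) (cong 𝟙 (does-∉-∷ʳ {xs = xs} (>⇒≢ x<m)))
... | inj₂ refl = begin
  suc (free (xs ∷ʳ x) x + 𝟙 (does (x ∉? xs ∷ʳ x)))
    ≡⟨ cong₂ (λ n b → suc (n + 𝟙 b)) (free-∷ʳ-≤ {xs} {x} ≤-refl)
             (dec-false (x ∉? xs ∷ʳ x) (λ x∉′ → x∉′ (∈-++⁺ʳ xs (here refl)))) ⟩
  suc (free xs x + 0)             ≡⟨ cong suc (+-identityʳ _) ⟩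
  suc (free xs x)                 ≡⟨ sym (free-suc-∉ x∉) ⟩
  free xs (suc x)                 ∎
  where open ≡-Reasoning

free-[0] : ∀ m → free (0 ∷ []) (suc m) ≡ m
free-[0] zero    = refl
free-[0] (suc m) = trans (cong (_+ 1) (free-[0] m)) (+-comm m 1)

-- c says whether the bound B grows by one.
free-∷ʳ-bound : ∀ {xs x B} → x ≤ B → x ∉ xs → All (_≤ B) xs →
               ∀ c → free (xs ∷ʳ x) (suc (B + 𝟙 c)) ≡ free xs (suc B) ∸ 1 + 𝟙 c
free-∷ʳ-bound {xs} {x} {B} x≤B x∉ bounded false = begin
  free (xs ∷ʳ x) (suc (B + 0))  ≡⟨ cong (free (xs ∷ʳ x) ∘ suc) (+-identityʳ B) ⟩
  free (xs ∷ʳ x) (suc B)        ≡⟨ cong (_∸ 1) (free-∷ʳ-> x∉ (s≤s x≤B)) ⟩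
  free xs (suc B) ∸ 1           ≡⟨ sym (+-identityʳ _) ⟩
  free xs (suc B) ∸ 1 + 0       ∎
  where open ≡-Reasoning
free-∷ʳ-bound {xs} {x} {B} x≤B x∉ bounded true = begin
  free (xs ∷ʳ x) (suc (B + 1))  ≡⟨ cong (free (xs ∷ʳ x) ∘ suc) (+-comm B 1) ⟩
  free (xs ∷ʳ x) (suc (suc B))
    ≡⟨ cong (λ b → free (xs ∷ʳ x) (suc B) + 𝟙 b) (dec-true (suc B ∉? xs ∷ʳ x) B+1∉) ⟩
  free (xs ∷ʳ x) (suc B) + 1    ≡⟨ cong (λ n → n ∸ 1 + 1) (free-∷ʳ-> x∉ (s≤s x≤B)) ⟩
  free xs (suc B) ∸ 1 + 1       ∎
  where
  open ≡-Reasoning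
  B+1∉ : suc B ∉ xs ∷ʳ x
  B+1∉ = ∉-∷ʳ (λ B+1∈ → n≮n B (All.lookup bounded B+1∈)) (>⇒≢ (s≤s x≤B))

<⇔free≤ : ∀ {xs ℓ x} → ℓ ∈ xs → x ∉ xs → (ℓ < x) ⇔ (free xs ℓ ≤ free xs x)
<⇔free≤ {xs} {ℓ} {x} ℓ∈ x∉ = mk⇔ (free-mono xs ∘ <⇒≤) from
  where
  from : free xs ℓ ≤ free xs x → ℓ < x
  from free≤ with ℓ <? x
  ... | yes ℓ<x = ℓ<x
  ... | no  ℓ≮x = contradiction
    (≤-trans (≤-trans (≤-reflexive (sym (free-suc-∉ x∉))) (free-mono xs x<ℓ)) free≤) (n≮n _)
    where
    x<ℓ : x < ℓ
    x<ℓ = ≤∧≢⇒< (≮⇒≥ ℓ≮x) (λ { refl → x∉ ℓ∈ })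

-- A sum over the values outside xs, reindexed by their rank among those values.
sumBelow-free : ∀ {xs ℓ} (g : ℕ → Bool → ℕ) → ℓ ∈ xs → ∀ m →
  sumBelow m (λ x → if does (x ∉? xs) then g (free xs x) (does (ℓ <? x)) else 0)
    ≡ sumBelow (free xs m) (λ v → g v (does (free xs ℓ ≤? v)))
sumBelow-free g ℓ∈ zero = refl
sumBelow-free {xs} {ℓ} g ℓ∈ (suc m) with m ∈? xs
... | yes m∈ =
  trans (+-identityʳ _)
        (trans (sumBelow-free g ℓ∈ m) (cong (λ n → sumBelow n _) (sym (+-identityʳ (free xs m)))))
... | no  m∉ =
  trans (cong₂ _+_ (sumBelow-free g ℓ∈ m)
                   (cong (g (free xs m)) (does-⇔ (<⇔free≤ ℓ∈ m∉) (ℓ <? m) (free xs ℓ ≤? free xs m))))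
        (cong (λ n → sumBelow n (λ v → g v (does (free xs ℓ ≤? v)))) (+-comm 1 (free xs m)))

lastFrom : ℕ → List ℕ → ℕ
lastFrom h []       = h
lastFrom h (y ∷ ys) = lastFrom y ys

lastFrom-∷ʳ : ∀ h t x → lastFrom h (t ∷ʳ x) ≡ x
lastFrom-∷ʳ h []      x = refl
lastFrom-∷ʳ h (y ∷ t) x = lastFrom-∷ʳ y t x

lastFrom-∈ : ∀ h t → lastFrom h t ∈ h ∷ t
lastFrom-∈ h []      = here refl
lastFrom-∈ h (y ∷ t) = there (lastFrom-∈ y t)

ascFrom-∷ʳ : ∀ h t x → ascFrom h (t ∷ʳ x) ≡ ascFrom h t + 𝟙 (does (lastFrom h t <? x))
ascFrom-∷ʳ h [] x with h <? x
... | yes h<x = cong 𝟙 (sym (dec-true (h <? x) h<x))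
... | no  h≮x = cong 𝟙 (sym (dec-false (h <? x) h≮x))
ascFrom-∷ʳ h (y ∷ t) x with h <? y
... | yes _ = cong suc (ascFrom-∷ʳ y t x)
... | no  _ = ascFrom-∷ʳ y t x

-- k ∸ 1 values stay free after the new letter; an ascent (i ≤ v) frees one more.
completions : ℕ → ℕ → ℕ → ℕ
completions zero    i k = 1
completions (suc r) i k = sumBelow k (λ v → completions r v (k ∸ 1 + 𝟙 (does (i ≤? v))))

module Extensions (p : ℕ) where

  bound : List ℕ → ℕ
  bound pre = p + asc pre

  Admissible : List ℕ → ℕ → Set
  Admissible pre x = x ≤ bound pre × x ∉ pre

  admissible? : ∀ pre x → Dec (Admissible pre x)
  admissible? pre x = x ≤? bound pre ×-dec x ∉? pre

  Extends : List ℕ → List ℕ → Set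
  Extends pre rest = TailOK p pre rest × Unique rest × All (_∉ pre) rest

  extends? : ∀ pre rest → Dec (Extends pre rest)
  extends? pre rest = tailOK? p pre rest ×-dec unique? rest ×-dec all? (_∉? pre) rest

  Valid : List ℕ → Set
  Valid pre = Unique pre × All (_≤ bound pre) pre

  extends-∷ : ∀ pre x rest → Extends pre (x ∷ rest) ⇔ (Admissible pre x × Extends (pre ∷ʳ x) rest)
  extends-∷ pre x rest = mk⇔ to from
    where
    to : Extends pre (x ∷ rest) → Admissible pre x × Extends (pre ∷ʳ x) rest
    to ((x≤ , ok) , (x≢rest ∷ u) , (x∉ ∷ rest∉)) =
      (x≤ , x∉) , ok , u , All.zipWith (λ (y∉ , x≢y) → ∉-∷ʳ y∉ (x≢y ∘ sym)) (rest∉ , x≢rest)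
    from : Admissible pre x × Extends (pre ∷ʳ x) rest → Extends pre (x ∷ rest)
    from ((x≤ , x∉) , ok , u , rest∉) =
      (x≤ , ok) , (All.map (λ y∉ x≡y → y∉ (∈-++⁺ʳ pre (here (sym x≡y)))) rest∉ ∷ u)
                , (x∉ ∷ All.map (λ y∉ y∈ → y∉ (∈-++⁺ˡ y∈)) rest∉)

  count-extends-∷ : ∀ pre x (L : List (List ℕ)) →
    count (does ∘ extends? pre) (map (x ∷_) L)
      ≡ (if does (admissible? pre x) then count (does ∘ extends? (pre ∷ʳ x)) L else 0)
  count-extends-∷ pre x L = begin
    count (does ∘ extends? pre) (map (x ∷_) L)
      ≡⟨ count-map (does ∘ extends? pre) (x ∷_) L ⟩
    count (λ rest → does (extends? pre (x ∷ rest))) L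
      ≡⟨ count-cong (λ rest → does-⇔ (extends-∷ pre x rest) (extends? pre (x ∷ rest))
                                     (admissible? pre x ×-dec extends? (pre ∷ʳ x) rest)) L ⟩
    count (λ rest → does (admissible? pre x) ∧ does (extends? (pre ∷ʳ x) rest)) L
      ≡⟨ count-∧ (does (admissible? pre x)) (does ∘ extends? (pre ∷ʳ x)) L ⟩
    (if does (admissible? pre x) then count (does ∘ extends? (pre ∷ʳ x)) L else 0) ∎
    where open ≡-Reasoning

  bound-∷ʳ : ∀ h t x → bound (h ∷ (t ∷ʳ x)) ≡ bound (h ∷ t) + 𝟙 (does (lastFrom h t <? x))
  bound-∷ʳ h t x = trans (cong (p +_) (ascFrom-∷ʳ h t x)) (sym (+-assoc p _ _))

  bound-∷ʳ-≤ : ∀ h t x → bound (h ∷ (t ∷ʳ x)) ≤ suc (bound (h ∷ t))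
  bound-∷ʳ-≤ h t x = begin
    bound (h ∷ (t ∷ʳ x))                          ≡⟨ bound-∷ʳ h t x ⟩
    bound (h ∷ t) + 𝟙 (does (lastFrom h t <? x))  ≤⟨ +-monoʳ-≤ (bound (h ∷ t)) (𝟙≤1 _) ⟩
    bound (h ∷ t) + 1                             ≡⟨ +-comm _ 1 ⟩
    suc (bound (h ∷ t))                           ∎
    where open ≤-Reasoning

  valid-∷ʳ : ∀ {h t x} → Valid (h ∷ t) → Admissible (h ∷ t) x → Valid (h ∷ (t ∷ʳ x))
  valid-∷ʳ {h} {t} {x} (u , bounded) (x≤ , x∉) =
    unique-∷ʳ u x∉ , All.map (λ y≤ → ≤-trans y≤ grows) (∷ʳ⁺ bounded x≤)
    where
    grows : bound (h ∷ t) ≤ bound (h ∷ (t ∷ʳ x))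
    grows = subst (bound (h ∷ t) ≤_) (sym (bound-∷ʳ h t x)) (m≤m+n _ _)

  count-extensions : ∀ b r h t → Valid (h ∷ t) → bound (h ∷ t) + r < b →
    count (does ∘ extends? (h ∷ t)) (lists b r)
      ≡ completions r (free (h ∷ t) (lastFrom h t)) (free (h ∷ t) (suc (bound (h ∷ t))))
  count-extensions b zero    h t _ _ = refl
  count-extensions b (suc r) h t valid B+r<b = begin
    count (does ∘ extends? pre) (lists b (suc r))
      ≡⟨ count-concatMap-upTo (does ∘ extends? pre) (λ x → map (x ∷_) L) b ⟩
    sumBelow b (λ x → count (does ∘ extends? pre) (map (x ∷_) L))
      ≡⟨ sumBelow-cong b (λ x _ → trans (count-extends-∷ pre x L) (nextLetter x)) ⟩
    sumBelow b (λ x → term (does (admissible? pre x)) x)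
      ≡⟨ sumBelow-vanishing _ aboveBound (≤-trans (s≤s (m≤m+n B (suc r))) B+r<b) ⟩
    sumBelow (suc B) (λ x → term (does (admissible? pre x)) x)
      ≡⟨ sumBelow-cong (suc B) (λ x x≤B → cong (λ a → term (a ∧ does (x ∉? pre)) x)
                                              (dec-true (x ≤? B) (≤-pred x≤B))) ⟩
    sumBelow (suc B) (λ x → term (does (x ∉? pre)) x)
      ≡⟨ sumBelow-free g (lastFrom-∈ h t) (suc B) ⟩
    completions (suc r) (free pre ℓ) k ∎
    where
    open ≡-Reasoning
    pre = h ∷ t
    L   = lists b r
    ℓ   = lastFrom h t
    B   = bound pre
    k   = free pre (suc B)

    g : ℕ → Bool → ℕ
    g v c = completions r v (k ∸ 1 + 𝟙 c)

    term : Bool → ℕ → ℕ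
    term a x = if a then g (free pre x) (does (ℓ <? x)) else 0

    afterLetter : ∀ {x} → Admissible pre x →
                  count (does ∘ extends? (pre ∷ʳ x)) L ≡ g (free pre x) (does (ℓ <? x))
    afterLetter {x} adm@(x≤B , x∉) =
      trans (count-extensions b r h (t ∷ʳ x) (valid-∷ʳ valid adm) B′+r<b)
            (cong₂ (completions r)
                   (trans (cong (free (pre ∷ʳ x)) (lastFrom-∷ʳ h t x)) (free-∷ʳ-≤ {pre} {x} ≤-refl))
                   (trans (cong (free (pre ∷ʳ x) ∘ suc) (bound-∷ʳ h t x))
                          (free-∷ʳ-bound x≤B x∉ (proj₂ valid) (does (ℓ <? x)))))
      where
      B′+r<b : bound (pre ∷ʳ x) + r < b
      B′+r<b = ≤-trans (s≤s (≤-trans (+-monoˡ-≤ r (bound-∷ʳ-≤ h t x)) (≤-reflexive (sym (+-suc B r)))))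
                       B+r<b

    nextLetter : ∀ x → (if does (admissible? pre x) then count (does ∘ extends? (pre ∷ʳ x)) L else 0)
                       ≡ term (does (admissible? pre x)) x
    nextLetter x = if-does-cong (admissible? pre x) afterLetter

    aboveBound : ∀ x → suc B ≤ x → term (does (admissible? pre x)) x ≡ 0
    aboveBound x B<x =
      cong (λ a → term a x) (dec-false (admissible? pre x) (λ (x≤B , _) → <⇒≱ B<x x≤B))

  startsExtension : ∀ rest → does (isPAscent? p (0 ∷ rest) ×-dec unique? (0 ∷ rest))
                             ≡ does (extends? (0 ∷ []) rest)
  startsExtension rest =
    does-⇔ (mk⇔ to from) (isPAscent? p (0 ∷ rest) ×-dec unique? (0 ∷ rest)) (extends? (0 ∷ []) rest)
    where
    to : IsPAscent p (0 ∷ rest) × Unique (0 ∷ rest) → Extends (0 ∷ []) rest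
    to (pasc ok , (0≢rest ∷ u)) = ok , u , All.map (λ { 0≢y (here y≡0) → 0≢y (sym y≡0) }) 0≢rest
    from : Extends (0 ∷ []) rest → IsPAscent p (0 ∷ rest) × Unique (0 ∷ rest)
    from (ok , u , rest∉) = pasc ok , (All.map (λ y∉ 0≡y → y∉ (here (sym 0≡y))) rest∉ ∷ u)

  a00-suc≡completions : ∀ m → a00 (suc m) p ≡ completions m 0 p
  a00-suc≡completions m = begin
    a00 (suc m) p
      ≡⟨ length-filter≡count _ (lists b (suc m)) ⟩
    count isSequence (lists b (suc m))
      ≡⟨ count-concatMap-upTo isSequence (λ x → map (x ∷_) L) b ⟩
    sumBelow b (λ x → count isSequence (map (x ∷_) L))
      ≡⟨ sumBelow-vanishing _ startsWith0 (s≤s z≤n) ⟩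
    count isSequence (map (0 ∷_) L)
      ≡⟨ trans (count-map isSequence (0 ∷_) L) (count-cong startsExtension L) ⟩
    count (does ∘ extends? (0 ∷ [])) L
      ≡⟨ count-extensions b m 0 [] (([] ∷ []) , (z≤n ∷ [])) bound<b ⟩
    completions m 0 (free (0 ∷ []) (suc (p + 0)))
      ≡⟨ cong (completions m 0) (trans (cong (free (0 ∷ []) ∘ suc) (+-identityʳ p)) (free-[0] p)) ⟩
    completions m 0 p ∎
    where
    open ≡-Reasoning
    b = suc (p + suc m)
    L = lists b m

    isSequence : List ℕ → Bool
    isSequence xs = does (isPAscent? p xs ×-dec unique? xs)

    startsWith0 : ∀ x → 1 ≤ x → count isSequence (map (x ∷_) L) ≡ 0
    startsWith0 (suc y) _ = trans (count-map isSequence (suc y ∷_) L) (count-false L)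

    bound<b : p + 0 + m < b
    bound<b = s≤s (≤-trans (≤-reflexive (cong (_+ m) (+-identityʳ p))) (+-monoʳ-≤ p (n≤1+n m)))

pascal : ∀ n k → suc n C suc k ≡ n C k + n C suc k
pascal n k = sym (nCk+nC[k+1]≡[n+1]C[k+1] n k)

pascal₂ : ∀ n → suc n C 2 ≡ n + n C 2
pascal₂ n = trans (pascal n 1) (cong (_+ n C 2) (nC1≡n n))

completions-0-1 : ∀ r → completions r 0 1 ≡ 1
completions-0-1 zero    = refl
completions-0-1 (suc r) = completions-0-1 r

completions-1-2 : ∀ r → completions r 1 2 ≡ suc r
completions-1-2 zero    = refl
completions-1-2 (suc r) = cong₂ _+_ (completions-0-1 r) (completions-1-2 r)

completions-0-2 : ∀ r → completions r 0 2 ≡ 1 + r + r C 2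
completions-0-2 zero    = refl
completions-0-2 (suc r) = begin
  completions r 0 2 + completions r 1 2
    ≡⟨ cong₂ _+_ (completions-0-2 r) (completions-1-2 r) ⟩
  (1 + r + r C 2) + suc r
    ≡⟨ rearrange r (r C 2) ⟩
  1 + suc r + (r + r C 2)
    ≡⟨ cong (1 + suc r +_) (sym (pascal₂ r)) ⟩
  1 + suc r + suc r C 2 ∎
  where
  open ≡-Reasoning
  rearrange : ∀ r c₂ → (1 + r + c₂) + suc r ≡ 1 + suc r + (r + c₂)
  rearrange = solve-∀

completions-2-3 : ∀ r → completions r 2 3 ≡ 1 + 2 * r + 2 * (r C 2) + r C 3
completions-2-3 zero    = refl
completions-2-3 (suc r) = begin
  completions r 0 2 + completions r 1 2 + completions r 2 3
    ≡⟨ cong₂ _+_ (cong₂ _+_ (completions-0-2 r) (completions-1-2 r)) (completions-2-3 r) ⟩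
  (1 + r + r C 2) + suc r + (1 + 2 * r + 2 * (r C 2) + r C 3)
    ≡⟨ rearrange r (r C 2) (r C 3) ⟩
  1 + 2 * suc r + 2 * (r + r C 2) + (r C 2 + r C 3)
    ≡⟨ cong₂ (λ a b → 1 + 2 * suc r + 2 * a + b) (sym (pascal₂ r)) (sym (pascal r 2)) ⟩
  1 + 2 * suc r + 2 * (suc r C 2) + suc r C 3 ∎
  where
  open ≡-Reasoning
  rearrange : ∀ r c₂ c₃ → (1 + r + c₂) + suc r + (1 + 2 * r + 2 * c₂ + c₃)
                          ≡ 1 + 2 * suc r + 2 * (r + c₂) + (c₂ + c₃)
  rearrange = solve-∀

completions-1-3 : ∀ r → completions r 1 3 ≡ 1 + 2 * r + 3 * (r C 2) + 3 * (r C 3) + r C 4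
completions-1-3 zero    = refl
completions-1-3 (suc r) = begin
  completions r 0 2 + completions r 1 3 + completions r 2 3
    ≡⟨ cong₂ _+_ (cong₂ _+_ (completions-0-2 r) (completions-1-3 r)) (completions-2-3 r) ⟩
  (1 + r + r C 2) + (1 + 2 * r + 3 * (r C 2) + 3 * (r C 3) + r C 4) + (1 + 2 * r + 2 * (r C 2) + r C 3)
    ≡⟨ rearrange r (r C 2) (r C 3) (r C 4) ⟩
  1 + 2 * suc r + 3 * (r + r C 2) + 3 * (r C 2 + r C 3) + (r C 3 + r C 4)
    ≡⟨ cong₂ (λ a b → 1 + 2 * suc r + 3 * a + 3 * b + (r C 3 + r C 4)) (sym (pascal₂ r)) (sym (pascal r 2)) ⟩
  1 + 2 * suc r + 3 * (suc r C 2) + 3 * (suc r C 3) + (r C 3 + r C 4)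
    ≡⟨ cong (1 + 2 * suc r + 3 * (suc r C 2) + 3 * (suc r C 3) +_) (sym (pascal r 3)) ⟩
  1 + 2 * suc r + 3 * (suc r C 2) + 3 * (suc r C 3) + suc r C 4 ∎
  where
  open ≡-Reasoning
  rearrange : ∀ r c₂ c₃ c₄ → (1 + r + c₂) + (1 + 2 * r + 3 * c₂ + 3 * c₃ + c₄) + (1 + 2 * r + 2 * c₂ + c₃)
                             ≡ 1 + 2 * suc r + 3 * (r + c₂) + 3 * (c₂ + c₃) + (c₃ + c₄)
  rearrange = solve-∀

completions-0-3 : ∀ r → completions r 0 3 ≡ 1 + 2 * r + 4 * (r C 2) + 5 * (r C 3) + 4 * (r C 4) + r C 5
completions-0-3 zero    = refl
completions-0-3 (suc r) = begin
  completions r 0 3 + completions r 1 3 + completions r 2 3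
    ≡⟨ cong₂ _+_ (cong₂ _+_ (completions-0-3 r) (completions-1-3 r)) (completions-2-3 r) ⟩
  (1 + 2 * r + 4 * (r C 2) + 5 * (r C 3) + 4 * (r C 4) + r C 5)
    + (1 + 2 * r + 3 * (r C 2) + 3 * (r C 3) + r C 4) + (1 + 2 * r + 2 * (r C 2) + r C 3)
    ≡⟨ rearrange r (r C 2) (r C 3) (r C 4) (r C 5) ⟩
  1 + 2 * suc r + 4 * (r + r C 2) + 5 * (r C 2 + r C 3) + 4 * (r C 3 + r C 4) + (r C 4 + r C 5)
    ≡⟨ cong₂ (λ a b → 1 + 2 * suc r + 4 * a + 5 * b + 4 * (r C 3 + r C 4) + (r C 4 + r C 5))
             (sym (pascal₂ r)) (sym (pascal r 2)) ⟩
  1 + 2 * suc r + 4 * (suc r C 2) + 5 * (suc r C 3) + 4 * (r C 3 + r C 4) + (r C 4 + r C 5)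
    ≡⟨ cong₂ (λ a b → 1 + 2 * suc r + 4 * (suc r C 2) + 5 * (suc r C 3) + 4 * a + b)
             (sym (pascal r 3)) (sym (pascal r 4)) ⟩
  1 + 2 * suc r + 4 * (suc r C 2) + 5 * (suc r C 3) + 4 * (suc r C 4) + suc r C 5 ∎
  where
  open ≡-Reasoning
  rearrange : ∀ r c₂ c₃ c₄ c₅ →
    (1 + 2 * r + 4 * c₂ + 5 * c₃ + 4 * c₄ + c₅) + (1 + 2 * r + 3 * c₂ + 3 * c₃ + c₄) + (1 + 2 * r + 2 * c₂ + c₃)
      ≡ 1 + 2 * suc r + 4 * (r + c₂) + 5 * (c₂ + c₃) + 4 * (c₃ + c₄) + (c₄ + c₅)
  rearrange = solve-∀

binomials-in-basis : ∀ r → ((suc r + 1) C 2) + 2 * (suc r C 3) + ((suc r ∸ 1) C 4) + ((suc r + 2) C 5)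
                           ≡ 1 + 2 * r + 4 * (r C 2) + 5 * (r C 3) + 4 * (r C 4) + r C 5
binomials-in-basis r = begin
  ((suc r + 1) C 2) + 2 * (suc r C 3) + (r C 4) + ((suc r + 2) C 5)
    ≡⟨ cong₂ (λ a b → (a C 2) + 2 * (suc r C 3) + (r C 4) + (b C 5)) (cong suc (+-comm r 1)) (cong suc (+-comm r 2)) ⟩
  (suc (suc r) C 2) + 2 * (suc r C 3) + (r C 4) + (suc (suc (suc r)) C 5)
    ≡⟨ cong₂ (λ a b → a + 2 * b + (r C 4) + (suc (suc (suc r)) C 5)) expand₂ (pascal r 2) ⟩
  suc r + (r + r C 2) + 2 * (r C 2 + r C 3) + (r C 4) + (suc (suc (suc r)) C 5)
    ≡⟨ cong (suc r + (r + r C 2) + 2 * (r C 2 + r C 3) + (r C 4) +_) expand₅ ⟩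
  suc r + (r + r C 2) + 2 * (r C 2 + r C 3) + (r C 4)
    + ((r C 2 + r C 3) + (r C 3 + r C 4) + ((r C 3 + r C 4) + (r C 4 + r C 5)))
    ≡⟨ rearrange r (r C 2) (r C 3) (r C 4) (r C 5) ⟩
  1 + 2 * r + 4 * (r C 2) + 5 * (r C 3) + 4 * (r C 4) + r C 5 ∎
  where
  open ≡-Reasoning
  expand₂ : suc (suc r) C 2 ≡ suc r + (r + r C 2)
  expand₂ = trans (pascal₂ (suc r)) (cong (suc r +_) (pascal₂ r))
  expand₅ : suc (suc (suc r)) C 5 ≡ (r C 2 + r C 3) + (r C 3 + r C 4) + ((r C 3 + r C 4) + (r C 4 + r C 5))
  expand₅ = trans (pascal (suc (suc r)) 4)
                  (cong₂ _+_ (trans (pascal (suc r) 3) (cong₂ _+_ (pascal r 2) (pascal r 3)))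
                             (trans (pascal (suc r) 4) (cong₂ _+_ (pascal r 3) (pascal r 4))))
  rearrange : ∀ r c₂ c₃ c₄ c₅ →
    suc r + (r + c₂) + 2 * (c₂ + c₃) + c₄ + ((c₂ + c₃) + (c₃ + c₄) + ((c₃ + c₄) + (c₄ + c₅)))
      ≡ 1 + 2 * r + 4 * c₂ + 5 * c₃ + 4 * c₄ + c₅
  rearrange = solve-∀

theorem4p2 : (n : ℕ) → 1 ≤ n →
    a00 n 3 ≡ ((n + 1) C 2) + 2 * (n C 3) + ((n ∸ 1) C 4) + ((n + 2) C 5)
theorem4p2 (suc r) _ = begin
  a00 (suc r) 3                                                       ≡⟨ Extensions.a00-suc≡completions 3 r ⟩
  completions r 0 3                                                   ≡⟨ completions-0-3 r ⟩
  1 + 2 * r + 4 * (r C 2) + 5 * (r C 3) + 4 * (r C 4) + r C 5         ≡⟨ sym (binomials-in-basis r) ⟩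
  ((suc r + 1) C 2) + 2 * (suc r C 3) + ((suc r ∸ 1) C 4) + ((suc r + 2) C 5) ∎
  where open ≡-Reasoning
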